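{- Let $A\in{\sf ASM}(n)$ with $A\neq I_n$. If $1\le i,j\le n$ and $(i,j)\notin\mathcal Ess(A)$, then there exists $(i',j')$ such that $[i,j,r_A(i,j)]_b<[i',j',r_A(i',j')]_b$.
   Context: An ASM of size $n$ is an $n\times n$ matrix $A=(a_{ij})$ with entries in $\{ -1,0,1\}$ whose nonzero entries alternate in sign along each row and column and each row and column sums to 1. $r_A(i,j)=\sum_{k\le i,\,l\le j}a_{kl}$. Order: $A\le B$ iff $r_A\ge r_B$ entrywise (on permutations this is Bruhat order; permutations are identified with permutation matrices with a 1 at $(i,w(i))$). $(i,j)$ is an inversion of $A$ if $\sum_{k>i,\,l>j}a_{il}a_{kj}=1$; $D(A)$ is the set of inversions; $\mathcal Ess(A)=\{(i,j)\in D(A):(i+1,j),(i,j+1)\notin D(A)\}$. For $i,j\ge1$, $0\le r<\min(i,j)$, $i+j-r\le n$, $[i,j,r]_b\in\mathcal S_n$ is the permutation $w$ with $w(t)=t$ for $t\le r$, $w(t)=t+j-r$ for $r<t\le i$, $w(t)=t-(i-r)$ for $i<t\le i+j-r$, $w(t)=t$ for $t>i+j-r$; if $r=\min(i,j)$, $[i,j,r]_b$ is the identity. (For any ASM, $r_A(i,j)\le\min(i,j)$ and $i+j-r_A(i,j)\le n$, so $[i,j,r_A(i,j)]_b$ is defined.) -}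

module Defs where

open import Data.Nat using (ℕ; zero; suc; _≤_; _<_; _∸_; _+_; _⊓_; _≤ᵇ_; _≡ᵇ_)
open import Data.Integer using (ℤ; +_; -_; ∣_∣) renaming (_+_ to _+ℤ_; _*_ to _*ℤ_; _≤_ to _≤ℤ_)
open import Data.Bool using (Bool; true; false; if_then_else_)
open import Data.Product using (_×_)
open import Data.Sum using (_⊎_)
open import Relation.Binary.PropositionalEquality using (_≡_; _≢_)
open import Relation.Nullary using (¬_)

-- Matrices are indexed 1-based by natural numbers; only entries with
-- indices in [1,n] are ever inspected.
Matrix : Set
Matrix = ℕ → ℕ → ℤ

sumTo : ℕ → (ℕ → ℤ) → ℤ
sumTo zero    f = + 0
sumTo (suc m) f = sumTo m f +ℤ f (suc m)

-- Σ_{t=a+1}^{b} f t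
sumFromTo : ℕ → ℕ → (ℕ → ℤ) → ℤ
sumFromTo a b f = sumTo (b ∸ a) (λ t → f (a + t))

InRange : ℕ → ℕ → Set
InRange n i = (1 ≤ i) × (i ≤ n)

record IsASM (n : ℕ) (A : Matrix) : Set where
  field
    entries : ∀ i j → InRange n i → InRange n j →
              (A i j ≡ + 0) ⊎ (A i j ≡ + 1) ⊎ (A i j ≡ - (+ 1))
    rowSum  : ∀ i → InRange n i → sumTo n (λ l → A i l) ≡ + 1
    colSum  : ∀ j → InRange n j → sumTo n (λ k → A k j) ≡ + 1
    rowAlt  : ∀ i l l' → InRange n i → 1 ≤ l → l < l' → l' ≤ n →
              A i l ≢ + 0 → A i l' ≢ + 0 →
              (∀ m → l < m → m < l' → A i m ≡ + 0) →
              A i l *ℤ A i l' ≡ - (+ 1)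
    colAlt  : ∀ j k k' → InRange n j → 1 ≤ k → k < k' → k' ≤ n →
              A k j ≢ + 0 → A k' j ≢ + 0 →
              (∀ m → k < m → m < k' → A m j ≡ + 0) →
              A k j *ℤ A k' j ≡ - (+ 1)

rk : Matrix → ℕ → ℕ → ℤ
rk A i j = sumTo i (λ k → sumTo j (λ l → A k l))

Id : Matrix
Id k l = if k ≡ᵇ l then + 1 else + 0

MatEq : ℕ → Matrix → Matrix → Set
MatEq n A B = ∀ k l → InRange n k → InRange n l → A k l ≡ B k l

Inv : ℕ → Matrix → ℕ → ℕ → Set
Inv n A i j = InRange n i × InRange n j ×
  (sumFromTo i n (λ k → sumFromTo j n (λ l → A i l *ℤ A k j)) ≡ + 1)

Ess : ℕ → Matrix → ℕ → ℕ → Set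
Ess n A i j = Inv n A i j × ¬ Inv n A (suc i) j × ¬ Inv n A i (suc j)

permMat : (ℕ → ℕ) → Matrix
permMat w k l = if w k ≡ᵇ l then + 1 else + 0

_≤[_]_ : Matrix → ℕ → Matrix → Set
A ≤[ n ] B = ∀ i j → InRange n i → InRange n j → rk B i j ≤ℤ rk A i j

_<[_]_ : Matrix → ℕ → Matrix → Set
A <[ n ] B = (A ≤[ n ] B) × ¬ MatEq n A B

bperm : ℕ → ℕ → ℕ → ℕ → ℕ
bperm i j r t =
  if (i ⊓ j) ≤ᵇ r then t else
  (if t ≤ᵇ r then t else
   (if t ≤ᵇ i then t + j ∸ r else
    (if t ≤ᵇ i + j ∸ r then t ∸ (i ∸ r) else t)))

-- [i,j,r_A(i,j)]_b as a permutation matrix (r_A(i,j) ≥ 0 for ASMs)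
bmat : Matrix → ℕ → ℕ → Matrix
bmat A i j = permMat (bperm i j ∣ rk A i j ∣)

module Submission where

-- Everything goes through the rank function of a bigrassmannian permutation, which is
-- computed in closed form first:
--     r_{[i,j,r]_b}(p,q) = min(p, q, r + (p ∸ i) + (q ∸ j))                  (bRank)
-- (for r ≥ min(i,j) this is min(p,q), the rank function of the identity).  Comparing two
-- such permutations in the order on ASMs thus reduces to comparing these closed forms.
-- From the ASM axioms we only need that every row and column prefix sum is 0 or 1
-- (proved for a single alternating sequence); hence 0 ≤ r_A ≤ min, and (i,j) is an
-- inversion iff both prefix sums at (i,j) vanish.  With r = r_A(i,j), the theorem follows:
--  * r = min(i,j): [i,j,r]_b = I, and since A ≠ I some r_A(p,q) < min(p,q); take (p,q);
--  * the row prefix sum at (i,j) is 1: r_A(i-1,j) = r-1, take (i-1,j);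
--  * the column prefix sum at (i,j) is 1: symmetrically take (i,j-1);
--  * both vanish: (i,j) is a non-essential inversion, so (i+1,j) or (i,j+1) is an
--    inversion of the same rank r; take that cell.

open import Defs
open import Data.Nat using (ℕ; zero; suc; _+_; _∸_; _⊓_; _≤_; _<_; z≤n; s≤s; _≤?_; _≡ᵇ_; _≤ᵇ_)
open import Data.Nat.Properties
open import Data.Nat.Tactic.RingSolver using (solve-∀)
open import Data.Integer as ℤ using (ℤ; +_; -_; ∣_∣; +≤+)
  renaming (_+_ to _+ℤ_; _*_ to _*ℤ_; _≤_ to _≤ℤ_)
import Data.Integer.Properties as ℤP
import Data.Integer.Tactic.RingSolver as ℤSolver
open import Data.Bool using (true; false; if_then_else_; T)
open import Data.Unit using (tt)
open import Data.Product using (Σ; _×_; _,_; proj₁; proj₂)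
open import Data.Sum using (_⊎_; inj₁; inj₂)
open import Data.Empty using (⊥-elim)
open import Relation.Binary.PropositionalEquality
open import Relation.Nullary using (¬_; Dec; yes; no)
open import Relation.Nullary.Decidable using (_×-dec_)
open import Algebra.Bundles using (AbelianGroup)
open import Algebra.Properties.Group (AbelianGroup.group ℤP.+-0-abelianGroup)
  using () renaming (∙-cancelˡ to +ℤ-cancelˡ)

sumTo-cong : ∀ m {f g : ℕ → ℤ} → (∀ t → 1 ≤ t → t ≤ m → f t ≡ g t) → sumTo m f ≡ sumTo m g
sumTo-cong zero    eq = refl
sumTo-cong (suc m) eq =
  cong₂ _+ℤ_ (sumTo-cong m (λ t t≥1 t≤m → eq t t≥1 (≤-trans t≤m (n≤1+n m)))) (eq (suc m) (s≤s z≤n) ≤-refl)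

sumTo-zero : ∀ m → sumTo m (λ _ → + 0) ≡ + 0
sumTo-zero zero    = refl
sumTo-zero (suc m) = cong (_+ℤ + 0) (sumTo-zero m)

sumTo-+ : ∀ m f g → sumTo m (λ t → f t +ℤ g t) ≡ sumTo m f +ℤ sumTo m g
sumTo-+ zero    f g = refl
sumTo-+ (suc m) f g rewrite sumTo-+ m f g = interchange (sumTo m f) (sumTo m g) (f (suc m)) (g (suc m))
  where
  interchange : ∀ a b c d → a +ℤ b +ℤ (c +ℤ d) ≡ a +ℤ c +ℤ (b +ℤ d)
  interchange = ℤSolver.solve-∀

sumTo-*ʳ : ∀ m f c → sumTo m (λ t → f t *ℤ c) ≡ sumTo m f *ℤ c
sumTo-*ʳ zero    f c = refl
sumTo-*ʳ (suc m) f c rewrite sumTo-*ʳ m f c = sym (ℤP.*-distribʳ-+ c (sumTo m f) (f (suc m)))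

sumTo-*ˡ : ∀ m f c → sumTo m (λ t → c *ℤ f t) ≡ c *ℤ sumTo m f
sumTo-*ˡ zero    f c = sym (ℤP.*-zeroʳ c)
sumTo-*ˡ (suc m) f c rewrite sumTo-*ˡ m f c = sym (ℤP.*-distribˡ-+ c (sumTo m f) (f (suc m)))

sumTo-append : ∀ k j f → sumTo (j + k) f ≡ sumTo j f +ℤ sumTo k (λ t → f (j + t))
sumTo-append zero    j f rewrite +-identityʳ j = sym (ℤP.+-identityʳ _)
sumTo-append (suc k) j f rewrite +-suc j k | sumTo-append k j f = ℤP.+-assoc (sumTo j f) _ _

sumTo-split : ∀ {j n} f → j ≤ n → sumTo n f ≡ sumTo j f +ℤ sumFromTo j n f
sumTo-split {j} {n} f j≤n = trans (cong (λ m → sumTo m f) (sym (m+[n∸m]≡n j≤n))) (sumTo-append (n ∸ j) j f)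

sumTo-swap : ∀ p q (h : ℕ → ℕ → ℤ) →
  sumTo p (λ k → sumTo q (λ l → h k l)) ≡ sumTo q (λ l → sumTo p (λ k → h k l))
sumTo-swap zero    q h = sym (sumTo-zero q)
sumTo-swap (suc p) q h rewrite sumTo-swap p q h = sym (sumTo-+ q (λ l → sumTo p (λ k → h k l)) (λ l → h (suc p) l))

sumTo-01 : ∀ m g → (∀ t → 1 ≤ t → t ≤ m → (g t ≡ + 0) ⊎ (g t ≡ + 1)) →
  Σ ℕ λ x → (sumTo m g ≡ + x) × (x ≤ m)
sumTo-01 zero    g g01 = 0 , refl , z≤n
sumTo-01 (suc m) g g01 with sumTo-01 m g (λ t t≥1 t≤m → g01 t t≥1 (≤-trans t≤m (n≤1+n m)))
                          | g01 (suc m) (s≤s z≤n) ≤-refl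
... | x , eq , x≤m | inj₁ g0 = x , trans (cong₂ _+ℤ_ eq g0) (cong +_ (+-identityʳ x)) , ≤-trans x≤m (n≤1+n m)
... | x , eq , x≤m | inj₂ g1 = suc x , trans (cong₂ _+ℤ_ eq g1) (cong +_ (+-comm x 1)) , s≤s x≤m

cancel-equal : ∀ {a a' x y : ℤ} → a ≡ a' → a +ℤ x ≡ a' +ℤ y → x ≡ y
cancel-equal {a} {x = x} {y} refl eq = +ℤ-cancelˡ a x y eq

-- After the first nonzero
-- entry u, each further nonzero entry is the negative of the previous one, so the prefix
-- sum is u right after an entry u and 0 right after an entry -u; the total sum then
-- forces u = 1.
module AlternatingSequence
  (n : ℕ) (f : ℕ → ℤ)
  (entry : ∀ l → 1 ≤ l → l ≤ n → (f l ≡ + 0) ⊎ (f l ≡ + 1) ⊎ (f l ≡ - (+ 1)))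
  (total : sumTo n f ≡ + 1)
  (alternate : ∀ l l' → 1 ≤ l → l < l' → l' ≤ n → f l ≢ + 0 → f l' ≢ + 0 →
               (∀ m → l < m → m < l' → f m ≡ + 0) → f l *ℤ f l' ≡ - (+ 1))
  where

  S : ℕ → ℤ
  S l = sumTo l f

  opposite : ∀ {a b : ℤ} → (a ≡ + 1) ⊎ (a ≡ - (+ 1)) → (b ≡ + 1) ⊎ (b ≡ - (+ 1)) →
             a *ℤ b ≡ - (+ 1) → b ≡ - a
  opposite (inj₁ refl) (inj₁ refl) ()
  opposite (inj₁ refl) (inj₂ refl) _ = refl
  opposite (inj₂ refl) (inj₁ refl) _ = refl
  opposite (inj₂ refl) (inj₂ refl) ()

  unit≢0 : ∀ {x : ℤ} → (x ≡ + 1) ⊎ (x ≡ - (+ 1)) → x ≢ + 0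
  unit≢0 (inj₁ refl) ()
  unit≢0 (inj₂ refl) ()

  unit : ∀ l → 1 ≤ l → l ≤ n → f l ≢ + 0 → (f l ≡ + 1) ⊎ (f l ≡ - (+ 1))
  unit l l≥1 l≤n f≢0 with entry l l≥1 l≤n
  ... | inj₁ f0 = ⊥-elim (f≢0 f0)
  ... | inj₂ f±1 = f±1

  -- The state after l entries once the first nonzero entry, of value u, has been seen:
  -- the last nonzero entry is at `last`, and the prefix sum is determined by its value.
  record Started (u : ℤ) (l : ℕ) : Set where
    field
      last   : ℕ
      last≥1 : 1 ≤ last
      last≤l : last ≤ l
      last≢0 : f last ≢ + 0
      quiet  : ∀ m → last < m → m ≤ l → f m ≡ + 0
      phase  : (S l ≡ u × f last ≡ u) ⊎ (S l ≡ + 0 × f last ≡ - u)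

  at : ∀ {u} l → f (suc l) ≢ + 0 →
       (S (suc l) ≡ u × f (suc l) ≡ u) ⊎ (S (suc l) ≡ + 0 × f (suc l) ≡ - u) → Started u (suc l)
  at l f≢0 ph = record
    { last = suc l ; last≥1 = s≤s z≤n ; last≤l = ≤-refl ; last≢0 = f≢0
    ; quiet = λ m l<m m≤l → ⊥-elim (<⇒≱ l<m m≤l) ; phase = ph }

  started-step : ∀ {u} l → suc l ≤ n → Started u l → Started u (suc l)
  started-step {u} l l<n st with entry (suc l) (s≤s z≤n) l<n
  ... | inj₁ f0 = record
    { last = last ; last≥1 = last≥1 ; last≤l = ≤-trans last≤l (n≤1+n l) ; last≢0 = last≢0
    ; quiet = quiet′ ; phase = Data.Sum.map (λ (s , e) → trans S0 s , e) (λ (s , e) → trans S0 s , e) phase }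
    where
    open Started st
    S0 : S (suc l) ≡ S l
    S0 = trans (cong (S l +ℤ_) f0) (ℤP.+-identityʳ (S l))
    quiet′ : ∀ m → last < m → m ≤ suc l → f m ≡ + 0
    quiet′ m last<m m≤l with m≤n⇒m<n∨m≡n m≤l
    ... | inj₁ m<l = quiet m last<m (≤-pred m<l)
    ... | inj₂ refl = f0
  ... | inj₂ f±1 = new phase
    where
    open Started st
    f≢0 : f (suc l) ≢ + 0
    f≢0 = unit≢0 f±1
    negated : f (suc l) ≡ - f last
    negated = opposite (unit last last≥1 (≤-trans last≤l (≤-trans (n≤1+n l) l<n)) last≢0) f±1
      (alternate last (suc l) last≥1 (s≤s last≤l) l<n last≢0 f≢0 (λ m last<m m<l → quiet m last<m (≤-pred m<l)))
    new : (S l ≡ u × f last ≡ u) ⊎ (S l ≡ + 0 × f last ≡ - u) → Started u (suc l)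
    new (inj₁ (s , e)) = at l f≢0 (inj₂ (trans (cong₂ _+ℤ_ s value) (ℤP.+-inverseʳ u) , value))
      where
      value : f (suc l) ≡ - u
      value = trans negated (cong -_ e)
    new (inj₂ (s , e)) = at l f≢0 (inj₁ (trans (cong₂ _+ℤ_ s value) (ℤP.+-identityˡ u) , value))
      where
      value : f (suc l) ≡ u
      value = trans negated (trans (cong -_ e) (ℤP.neg-involutive u))

  prefix : ∀ l → l ≤ n → (S l ≡ + 0) ⊎ Σ ℤ λ u → Started u l
  prefix zero    _   = inj₁ refl
  prefix (suc l) l<n with prefix l (≤-trans (n≤1+n l) l<n)
  ... | inj₂ (u , st) = inj₂ (u , started-step l l<n st)
  ... | inj₁ S0 with entry (suc l) (s≤s z≤n) l<n
  ...   | inj₁ f0 = inj₁ (cong₂ _+ℤ_ S0 f0)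
  ...   | inj₂ f±1 = inj₂ (f (suc l) , at l (unit≢0 f±1) (inj₁ (trans (cong (_+ℤ f (suc l)) S0) (ℤP.+-identityˡ _) , refl)))

  started-until : ∀ {u} k l → k + l ≤ n → Started u l → Started u (k + l)
  started-until zero    l _   st = st
  started-until (suc k) l k+l<n st = started-step (k + l) k+l<n (started-until k l (≤-trans (n≤1+n _) k+l<n) st)

  first-is-one : ∀ {u} l → l ≤ n → Started u l → u ≡ + 1
  first-is-one {u} l l≤n st with Started.phase (started-until (n ∸ l) l (≤-reflexive (m∸n+n≡m l≤n)) st)
  ... | inj₁ (s , _) = trans (sym s) (trans (cong S (m∸n+n≡m l≤n)) total)
  ... | inj₂ (s , _) with trans (sym s) (trans (cong S (m∸n+n≡m l≤n)) total)
  ...   | ()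

  -- the prefix sums are 0 before the start, and u = 1 or 0 afterwards
  prefixSum01 : ∀ l → l ≤ n → (S l ≡ + 0) ⊎ (S l ≡ + 1)
  prefixSum01 l l≤n with prefix l l≤n
  ... | inj₁ S0 = inj₁ S0
  ... | inj₂ (u , st) with Started.phase st | first-is-one l l≤n st
  ...   | inj₁ (s , _) | refl = inj₂ s
  ...   | inj₂ (s , _) | _    = inj₁ s

-- Rank functions of matrices.  Adding a row is definitional,
-- rk A (suc i) j ≡ rk A i j + Σ_{l ≤ j} A (i+1) l; adding a column interchanges two sums.
rk-sucCol : ∀ A i j → rk A i (suc j) ≡ rk A i j +ℤ sumTo i (λ k → A k (suc j))
rk-sucCol A i j = sumTo-+ i (λ k → sumTo j (A k)) (λ k → A k (suc j))

rk-cong : ∀ {n B C} → MatEq n B C → ∀ p q → p ≤ n → q ≤ n → rk B p q ≡ rk C p q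
rk-cong eq p q p≤n q≤n =
  sumTo-cong p (λ k k≥1 k≤p → sumTo-cong q (λ l l≥1 l≤q → eq k l (k≥1 , ≤-trans k≤p p≤n) (l≥1 , ≤-trans l≤q q≤n)))

rk-determines : ∀ {n B C} → (∀ p q → p ≤ n → q ≤ n → rk B p q ≡ rk C p q) → MatEq n B C
rk-determines same zero    l       (() , _) _
rk-determines same (suc k) zero    _        (() , _)
rk-determines {n} {B} {C} same (suc k) (suc l) (_ , k<n) (_ , l<n) =
  cancel-equal (rowPrefix l (≤-trans (n≤1+n l) l<n)) (rowPrefix (suc l) l<n)
  where
  rowPrefix : ∀ m → m ≤ n → sumTo m (B (suc k)) ≡ sumTo m (C (suc k))
  rowPrefix m m≤n = cancel-equal (same k m (≤-trans (n≤1+n k) k<n) m≤n) (same (suc k) m k<n m≤n)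

χ≤ : ℕ → ℕ → ℕ
χ≤ zero    q       = 1
χ≤ (suc c) zero    = 0
χ≤ (suc c) (suc q) = χ≤ c q

χ∈ : ℕ → ℕ → ℕ
χ∈ zero    q = 0
χ∈ (suc c) q = χ≤ (suc c) q

χ≤-shift : ∀ k c q → χ≤ (k + c) (k + q) ≡ χ≤ c q
χ≤-shift zero    c q = refl
χ≤-shift (suc k) c q = χ≤-shift k c q

χ≤-1 : ∀ {c q} → c ≤ q → χ≤ c q ≡ 1
χ≤-1 {zero}          _         = refl
χ≤-1 {suc c} {suc q} (s≤s c≤q) = χ≤-1 c≤q

χ≤-0 : ∀ {c q} → q < c → χ≤ c q ≡ 0
χ≤-0 {suc c} {zero}  _         = refl
χ≤-0 {suc c} {suc q} (s≤s q<c) = χ≤-0 q<c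

χ≤-split : ∀ c q → χ≤ c q ≡ χ≤ (suc c) q + (if c ≡ᵇ q then 1 else 0)
χ≤-split zero    zero    = refl
χ≤-split zero    (suc q) = refl
χ≤-split (suc c) zero    = refl
χ≤-split (suc c) (suc q) = χ≤-split c q

min-suc : ∀ p q → suc p ⊓ q ≡ p ⊓ q + χ≤ (suc p) q
min-suc p       zero    = sym (cong (_+ 0) (⊓-zeroʳ p))
min-suc zero    (suc q) = refl
min-suc (suc p) (suc q) = cong suc (min-suc p q)

if-ℤ : ∀ b → (if b then + 1 else + 0) ≡ + (if b then 1 else 0)
if-ℤ true  = refl
if-ℤ false = refl

permMat-rowSum : ∀ c q → sumTo q (λ l → if c ≡ᵇ l then + 1 else + 0) ≡ + χ∈ c q
permMat-rowSum zero    zero    = refl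
permMat-rowSum (suc c) zero    = refl
permMat-rowSum zero    (suc q) = cong (_+ℤ + 0) (permMat-rowSum zero q)
permMat-rowSum (suc c) (suc q) = begin
  sumTo q (λ l → if suc c ≡ᵇ l then + 1 else + 0) +ℤ (if c ≡ᵇ q then + 1 else + 0)
    ≡⟨ cong₂ _+ℤ_ (permMat-rowSum (suc c) q) (if-ℤ (c ≡ᵇ q)) ⟩
  + (χ≤ (suc c) q + (if c ≡ᵇ q then 1 else 0))
    ≡⟨ cong +_ (sym (χ≤-split c q)) ⟩
  + χ≤ c q ∎
  where open ≡-Reasoning

rk-permMat : ∀ w (G : ℕ → ℕ → ℕ) → (∀ q → G 0 q ≡ 0) →
  (∀ p q → G (suc p) q ≡ G p q + χ∈ (w (suc p)) q) → ∀ p q → rk (permMat w) p q ≡ + G p q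
rk-permMat w G G0 Gsuc zero    q = cong +_ (sym (G0 q))
rk-permMat w G G0 Gsuc (suc p) q =
  trans (cong₂ _+ℤ_ (rk-permMat w G G0 Gsuc p q) (permMat-rowSum (w (suc p)) q)) (cong +_ (sym (Gsuc p q)))

rk-Id : ∀ p q → rk Id p q ≡ + (p ⊓ q)
rk-Id = rk-permMat (λ t → t) _⊓_ (λ _ → refl) min-suc

bound : ℕ → ℕ → ℕ → ℕ → ℕ → ℕ
bound i j r p q = r + (p ∸ i) + (q ∸ j)

bRank : ℕ → ℕ → ℕ → ℕ → ℕ → ℕ
bRank i j r p q = p ⊓ q ⊓ bound i j r p q

r≤bound : ∀ i j r p q → r ≤ bound i j r p q
r≤bound i j r p q = ≤-trans (m≤m+n r (p ∸ i)) (m≤m+n (r + (p ∸ i)) (q ∸ j))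

min3-dropFirst : ∀ {x} y {z} → z ≤ x → (x ⊓ y) ⊓ z ≡ y ⊓ z
min3-dropFirst {x} y {z} z≤x = trans (⊓-assoc x y z) (m≥n⇒m⊓n≡n (≤-trans (m⊓n≤n y z) z≤x))

min3-dropSecond : ∀ x {y z} → z ≤ y → (x ⊓ y) ⊓ z ≡ x ⊓ z
min3-dropSecond x {y} {z} z≤y = trans (⊓-assoc x y z) (cong (x ⊓_) (m≥n⇒m⊓n≡n z≤y))

bRank-low : ∀ i j r x q → x ≤ r → bRank i j r x q ≡ x ⊓ q
bRank-low i j r x q x≤r = m≤n⇒m⊓n≡m (≤-trans (m⊓n≤m x q) (≤-trans x≤r (r≤bound i j r x q)))

bRank-narrow : ∀ i j r x q → q ≤ r → q ≤ x → bRank i j r x q ≡ q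
bRank-narrow i j r x q q≤r q≤x =
  trans (m≤n⇒m⊓n≡m (≤-trans (m⊓n≤n x q) (≤-trans q≤r (r≤bound i j r x q)))) (m≥n⇒m⊓n≡n q≤x)

bRank-trivial : ∀ i j r x q → i ⊓ j ≤ r → bRank i j r x q ≡ x ⊓ q
bRank-trivial i j r x q i⊓j≤r with ⊓-sel i j
... | inj₁ i⊓j≡i = m≤n⇒m⊓n≡m (≤-trans (m⊓n≤m x q) (≤-trans (m≤n+m∸n x i)
        (≤-trans (+-monoˡ-≤ (x ∸ i) (subst (_≤ r) i⊓j≡i i⊓j≤r)) (m≤m+n _ _))))
... | inj₂ i⊓j≡j = m≤n⇒m⊓n≡m (≤-trans (m⊓n≤n x q) (≤-trans (m≤n+m∸n q j)
        (+-monoˡ-≤ (q ∸ j) (≤-trans (subst (_≤ r) i⊓j≡j i⊓j≤r) (m≤m+n r _)))))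

bRank-shift : ∀ r a b x y → bRank (r + a) (r + b) r (r + x) (r + y) ≡ r + bRank a b 0 x y
bRank-shift r a b x y = begin
  (r + x) ⊓ (r + y) ⊓ (r + ((r + x) ∸ (r + a)) + ((r + y) ∸ (r + b)))
    ≡⟨ cong₂ (λ u v → (r + x) ⊓ (r + y) ⊓ (r + u + v)) ([m+n]∸[m+o]≡n∸o r x a) ([m+n]∸[m+o]≡n∸o r y b) ⟩
  (r + x) ⊓ (r + y) ⊓ (r + (x ∸ a) + (y ∸ b))
    ≡⟨ cong₂ _⊓_ (sym (+-distribˡ-⊓ r x y)) (+-assoc r (x ∸ a) (y ∸ b)) ⟩
  (r + (x ⊓ y)) ⊓ (r + ((x ∸ a) + (y ∸ b)))
    ≡⟨ sym (+-distribˡ-⊓ r _ _) ⟩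
  r + bRank a b 0 x y ∎
  where open ≡-Reasoning

≤ᵇ-true : ∀ {m n} → m ≤ n → (m ≤ᵇ n) ≡ true
≤ᵇ-true {m} {n} m≤n with m ≤ᵇ n | ≤⇒≤ᵇ m≤n
... | true | _ = refl

≤ᵇ-false : ∀ {m n} → n < m → (m ≤ᵇ n) ≡ false
≤ᵇ-false {m} {n} n<m with m ≤ᵇ n in eq
... | false = refl
... | true  = ⊥-elim (<⇒≱ n<m (≤ᵇ⇒≤ m n (subst T (sym eq) tt)))

bperm-trivial : ∀ i j r t → i ⊓ j ≤ r → bperm i j r t ≡ t
bperm-trivial i j r t h rewrite ≤ᵇ-true h = refl

bperm-fixLow : ∀ i j r t → r < i ⊓ j → t ≤ r → bperm i j r t ≡ t
bperm-fixLow i j r t h t≤r rewrite ≤ᵇ-false h | ≤ᵇ-true t≤r = refl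

bperm-up : ∀ i j r t → r < i ⊓ j → r < t → t ≤ i → bperm i j r t ≡ t + j ∸ r
bperm-up i j r t h r<t t≤i rewrite ≤ᵇ-false h | ≤ᵇ-false r<t | ≤ᵇ-true t≤i = refl

bperm-down : ∀ i j r t → r < i ⊓ j → r < t → i < t → t ≤ i + j ∸ r → bperm i j r t ≡ t ∸ (i ∸ r)
bperm-down i j r t h r<t i<t t≤m rewrite ≤ᵇ-false h | ≤ᵇ-false r<t | ≤ᵇ-false i<t | ≤ᵇ-true t≤m = refl

bperm-fixHigh : ∀ i j r t → r < i ⊓ j → r < t → i < t → i + j ∸ r < t → bperm i j r t ≡ t
bperm-fixHigh i j r t h r<t i<t m<t rewrite ≤ᵇ-false h | ≤ᵇ-false r<t | ≤ᵇ-false i<t | ≤ᵇ-false m<t = refl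

RankStep : ℕ → ℕ → ℕ → ℕ → ℕ → Set
RankStep i j r p q = bRank i j r (suc p) q ≡ bRank i j r p q + χ∈ (bperm i j r (suc p)) q

fixedStep : ∀ i j r p q → bperm i j r (suc p) ≡ suc p →
  bRank i j r (suc p) q ≡ suc p ⊓ q → bRank i j r p q ≡ p ⊓ q → RankStep i j r p q
fixedStep i j r p q fixes at-suc at-p = begin
  bRank i j r (suc p) q                         ≡⟨ at-suc ⟩
  suc p ⊓ q                                     ≡⟨ min-suc p q ⟩
  p ⊓ q + χ≤ (suc p) q                          ≡⟨ cong₂ (λ x c → x + χ∈ c q) (sym at-p) (sym fixes) ⟩
  bRank i j r p q + χ∈ (bperm i j r (suc p)) q  ∎
  where open ≡-Reasoning

-- For r < min(i,j) write i = r + a, j = r + b.  The rows p+1 ≤ r and p+1 > i + j - r are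
-- fixed points; on the rows in between, [i,j,r]_b maps into (r, i+j-r], and translating
-- by r reduces the recursion to one for G = bRank a b 0.
module NontrivialRankStep (r a b : ℕ) (a≥1 : 1 ≤ a) (b≥1 : 1 ≤ b) where
  i j : ℕ
  i = r + a
  j = r + b

  w : ℕ → ℕ
  w = bperm i j r

  G : ℕ → ℕ → ℕ
  G = bRank a b 0

  r<min : r < i ⊓ j
  r<min = subst (r <_) (+-distribˡ-⊓ r a b) (subst (_≤ r + (a ⊓ b)) (+-comm r 1) (+-monoʳ-≤ r (⊓-mono-≤ a≥1 b≥1)))

  i+j∸r : i + j ∸ r ≡ r + a + b
  i+j∸r = trans (cong (_∸ r) (rearrange r a b)) (m+n∸m≡n r (r + a + b))
    where
    rearrange : ∀ r a b → (r + a) + (r + b) ≡ r + (r + a + b)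
    rearrange = solve-∀

  bRank-high : ∀ x q → r + a + b ≤ x → bRank i j r x q ≡ x ⊓ q
  bRank-high x q h = m≤n⇒m⊓n≡m (≤-trans (m⊓n≤n x q) (≤-trans (m≤n+m∸n q j) (+-monoˡ-≤ (q ∸ j) (+-monoʳ-≤ r b≤x∸i))))
    where
    rearrange : ∀ r a b → r + a + b ≡ b + (r + a)
    rearrange = solve-∀
    b≤x∸i : b ≤ x ∸ i
    b≤x∸i = m+n≤o⇒m≤o∸n b (subst (_≤ x) (rearrange r a b) h)

  -- G on the rows 1..a (where [a,b,0]_b moves t to t + b)
  G-upperLeft : ∀ x y → x ≤ a → y ≤ b → G x y ≡ 0
  G-upperLeft x y x≤a y≤b rewrite m≤n⇒m∸n≡0 x≤a | m≤n⇒m∸n≡0 y≤b = ⊓-zeroʳ (x ⊓ y)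

  G-upperRight : ∀ x e → x ≤ a → G x (b + e) ≡ x ⊓ e
  G-upperRight x e x≤a rewrite m≤n⇒m∸n≡0 x≤a | m+n∸m≡n b e = min3-dropSecond x (m≤n+m e b)

  G-up : ∀ d y → suc d ≤ a → G (suc d) y ≡ G d y + χ≤ (suc (b + d)) y
  G-up d y d<a with y ≤? b
  ... | yes y≤b rewrite G-upperLeft (suc d) y d<a y≤b | G-upperLeft d y (≤-trans (n≤1+n d) d<a) y≤b
          | χ≤-0 {suc (b + d)} {y} (s≤s (≤-trans y≤b (m≤m+n b d))) = refl
  ... | no y≰b = subst (λ y → G (suc d) y ≡ G d y + χ≤ (suc (b + d)) y) (m+[n∸m]≡n (≰⇒≥ y≰b)) (right (y ∸ b))
    where
    right : ∀ e → G (suc d) (b + e) ≡ G d (b + e) + χ≤ (suc (b + d)) (b + e)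
    right e rewrite G-upperRight (suc d) e d<a | G-upperRight d e (≤-trans (n≤1+n d) d<a)
      | sym (+-suc b d) | χ≤-shift b (suc d) e = min-suc d e

  -- G on the rows a+1..a+b (where [a,b,0]_b moves a + t to t)
  G-lowerLeft : ∀ x y → y ≤ b → G (a + x) y ≡ y ⊓ x
  G-lowerLeft x y y≤b rewrite m+n∸m≡n a x | m≤n⇒m∸n≡0 y≤b | +-identityʳ x = min3-dropFirst y (m≤n+m x a)

  G-lowerRight : ∀ x e → x ≤ b → G (a + x) (b + e) ≡ x + (a ⊓ e)
  G-lowerRight x e x≤b rewrite m+n∸m≡n a x | m+n∸m≡n b e =
    trans (min3-dropSecond (a + x) (+-monoˡ-≤ e x≤b))
      (trans (cong (_⊓ (x + e)) (+-comm a x)) (sym (+-distribˡ-⊓ x a e)))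

  G-down : ∀ d y → suc d ≤ b → G (a + suc d) y ≡ G (a + d) y + χ≤ (suc d) y
  G-down d y d<b with y ≤? b
  ... | yes y≤b rewrite G-lowerLeft (suc d) y y≤b | G-lowerLeft d y y≤b | ⊓-comm y (suc d) | ⊓-comm y d = min-suc d y
  ... | no y≰b = subst (λ y → G (a + suc d) y ≡ G (a + d) y + χ≤ (suc d) y) (m+[n∸m]≡n (≰⇒≥ y≰b)) (right (y ∸ b))
    where
    right : ∀ e → G (a + suc d) (b + e) ≡ G (a + d) (b + e) + χ≤ (suc d) (b + e)
    right e rewrite G-lowerRight (suc d) e d<b | G-lowerRight d e (≤-trans (n≤1+n d) d<b)
      | χ≤-1 {suc d} {b + e} (≤-trans d<b (m≤m+n b e)) = +-comm 1 (d + a ⊓ e)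

  shiftedStep : ∀ x c → w (suc (r + x)) ≡ suc (r + c) →
    (∀ y → G (suc x) y ≡ G x y + χ≤ (suc c) y) → ∀ q → RankStep i j r (r + x) q
  shiftedStep x c sends Gsuc q with q ≤? r
  ... | yes q≤r rewrite sends = begin
    bRank i j r (suc (r + x)) q             ≡⟨ bRank-narrow i j r (suc (r + x)) q q≤r (≤-trans q≤r (≤-trans (m≤m+n r x) (n≤1+n _))) ⟩
    q                                       ≡⟨ sym (+-identityʳ q) ⟩
    q + 0                                   ≡⟨ cong₂ _+_ (sym (bRank-narrow i j r (r + x) q q≤r (≤-trans q≤r (m≤m+n r x))))
                                                          (sym (χ≤-0 (s≤s (≤-trans q≤r (m≤m+n r c))))) ⟩
    bRank i j r (r + x) q + χ≤ (suc (r + c)) q ∎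
    where open ≡-Reasoning
  ... | no q≰r = subst (RankStep i j r (r + x)) (m+[n∸m]≡n (≰⇒≥ q≰r)) (shifted (q ∸ r))
    where
    open ≡-Reasoning
    shifted : ∀ y → RankStep i j r (r + x) (r + y)
    shifted y = begin
      bRank i j r (suc (r + x)) (r + y)         ≡⟨ cong (λ p → bRank i j r p (r + y)) (sym (+-suc r x)) ⟩
      bRank i j r (r + suc x) (r + y)           ≡⟨ bRank-shift r a b (suc x) y ⟩
      r + G (suc x) y                           ≡⟨ cong (λ v → r + v) (Gsuc y) ⟩
      r + (G x y + χ≤ (suc c) y)                ≡⟨ sym (+-assoc r _ _) ⟩
      r + G x y + χ≤ (suc c) y                  ≡⟨ cong₂ _+_ (sym (bRank-shift r a b x y)) (sym (χ≤-shift r (suc c) y)) ⟩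
      bRank i j r (r + x) (r + y) + χ≤ (r + suc c) (r + y)
                                                ≡⟨ cong (λ v → bRank i j r (r + x) (r + y) + χ≤ v (r + y)) (+-suc r c) ⟩
      bRank i j r (r + x) (r + y) + χ∈ (suc (r + c)) (r + y)
                                                ≡⟨ cong (λ v → bRank i j r (r + x) (r + y) + χ∈ v (r + y)) (sym sends) ⟩
      bRank i j r (r + x) (r + y) + χ∈ (w (suc (r + x))) (r + y) ∎

  w-up : ∀ d → suc d ≤ a → w (suc (r + d)) ≡ suc (r + (b + d))
  w-up d d<a = trans (bperm-up i j r (suc (r + d)) r<min (s≤s (m≤m+n r d)) (subst (_≤ i) (+-suc r d) (+-monoʳ-≤ r d<a)))
    (trans (cong (_∸ r) (rearrange r b d)) (m+n∸m≡n r _))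
    where
    rearrange : ∀ r b d → suc (r + d) + (r + b) ≡ r + suc (r + (b + d))
    rearrange = solve-∀

  w-down : ∀ d → suc d ≤ b → w (suc (r + (a + d))) ≡ suc (r + d)
  w-down d d<b = trans (bperm-down i j r (suc (r + (a + d))) r<min (s≤s (m≤m+n r _)) (s≤s (+-monoʳ-≤ r (m≤m+n a d)))
      (subst (suc (r + (a + d)) ≤_) (sym i+j∸r) (subst (_≤ r + a + b) (shuffle₁ r a d) (+-monoʳ-≤ (r + a) d<b))))
    (trans (cong (suc (r + (a + d)) ∸_) (m+n∸m≡n r a)) (trans (cong (_∸ a) (shuffle₂ r a d)) (m+n∸m≡n a _)))
    where
    shuffle₁ : ∀ r a d → r + a + suc d ≡ suc (r + (a + d))
    shuffle₁ = solve-∀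
    shuffle₂ : ∀ r a d → suc (r + (a + d)) ≡ a + suc (r + d)
    shuffle₂ = solve-∀

  upStep : ∀ d q → suc d ≤ a → RankStep i j r (r + d) q
  upStep d q d<a = shiftedStep d (b + d) (w-up d d<a) (λ y → G-up d y d<a) q

  downStep : ∀ d q → suc d ≤ b → RankStep i j r (r + (a + d)) q
  downStep d q d<b = shiftedStep (a + d) d (w-down d d<b)
    (λ y → trans (cong (λ x → G x y) (sym (+-suc a d))) (G-down d y d<b)) q

  offset< : ∀ {s p c} → s ≤ p → suc p ≤ s + c → suc (p ∸ s) ≤ c
  offset< {s} {p} {c} s≤p h = +-cancelˡ-≤ s _ _ (subst (_≤ s + c) (trans (cong suc (sym (m+[n∸m]≡n s≤p))) (sym (+-suc s _))) h)

  rankStep : ∀ p q → RankStep i j r p q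
  rankStep p q with suc p ≤? r
  ... | yes low = fixedStep i j r p q (bperm-fixLow i j r (suc p) r<min low) (bRank-low i j r (suc p) q low)
                    (bRank-low i j r p q (≤-trans (n≤1+n p) low))
  ... | no ¬low with suc p ≤? i
  ...   | yes up = subst (λ p → RankStep i j r p q) (m+[n∸m]≡n r≤p) (upStep (p ∸ r) q (offset< r≤p up))
    where r≤p = ≤-pred (≰⇒> ¬low)
  ...   | no ¬up with suc p ≤? r + a + b
  ...     | yes down = subst (λ p → RankStep i j r p q) (trans (sym (+-assoc r a _)) (m+[n∸m]≡n i≤p))
                         (downStep (p ∸ i) q (offset< i≤p down))
    where i≤p = ≤-pred (≰⇒> ¬up)
  ...     | no ¬down = fixedStep i j r p q
    (bperm-fixHigh i j r (suc p) r<min (s≤s (≤-trans (m≤m+n r a) (≤-trans (m≤m+n (r + a) b) high)))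
      (s≤s (≤-trans (m≤m+n (r + a) b) high)) (subst (_< suc p) (sym i+j∸r) (s≤s high)))
    (bRank-high (suc p) q (≤-trans high (n≤1+n p))) (bRank-high p q high)
    where high = ≤-pred (≰⇒> ¬down)

rankStep : ∀ i j r p q → RankStep i j r p q
rankStep i j r p q with i ⊓ j ≤? r
... | yes trivial = fixedStep i j r p q (bperm-trivial i j r (suc p) trivial)
                      (bRank-trivial i j r (suc p) q trivial) (bRank-trivial i j r p q trivial)
... | no ¬trivial = subst₂ (λ i j → RankStep i j r p q) (m+[n∸m]≡n (<⇒≤ r<i)) (m+[n∸m]≡n (<⇒≤ r<j))
        (NontrivialRankStep.rankStep r (i ∸ r) (j ∸ r) (m+n≤o⇒m≤o∸n 1 r<i) (m+n≤o⇒m≤o∸n 1 r<j) p q)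
  where
  r<i = ≤-trans (≰⇒> ¬trivial) (m⊓n≤m i j)
  r<j = ≤-trans (≰⇒> ¬trivial) (m⊓n≤n i j)

rk-bperm : ∀ i j r p q → rk (permMat (bperm i j r)) p q ≡ + bRank i j r p q
rk-bperm i j r = rk-permMat (bperm i j r) (bRank i j r) (λ _ → refl) (rankStep i j r)

bRank-≤-min : ∀ i j r p q → bRank i j r p q ≤ p ⊓ q
bRank-≤-min i j r p q = m⊓n≤m (p ⊓ q) _

bRank-corner : ∀ i j r → bRank i j r i j ≤ r
bRank-corner i j r = ≤-trans (m⊓n≤n (i ⊓ j) _)
  (≤-reflexive (trans (cong₂ (λ u v → r + u + v) (n∸n≡0 i) (n∸n≡0 j)) (trans (+-identityʳ (r + 0)) (+-identityʳ r))))

bRank-≥ : ∀ {x} i j r p q → x ≤ p → x ≤ q → x ≤ bound i j r p q → x ≤ bRank i j r p q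
bRank-≥ i j r p q x≤p x≤q x≤bound = ⊓-glb (⊓-glb x≤p x≤q) x≤bound

bRank-mono : ∀ {i j r i' j' r'} → (∀ p q → bound i' j' r' p q ≤ bound i j r p q) →
  ∀ p q → bRank i' j' r' p q ≤ bRank i j r p q
bRank-mono le p q = ⊓-monoʳ-≤ (p ⊓ q) (le p q)

corner-strict : ∀ {i j r} i' j' r' → r' < i' → r' < j' → r' < bound i j r i' j' →
  bRank i' j' r' i' j' < bRank i j r i' j'
corner-strict {i} {j} {r} i' j' r' r'<i' r'<j' r'<bound =
  ≤-<-trans (bRank-corner i' j' r') (bRank-≥ i j r i' j' r'<i' r'<j' r'<bound)

∸-suc-≤ : ∀ p i → p ∸ i ≤ suc (p ∸ suc i)
∸-suc-≤ zero    i       = ≤-trans (≤-reflexive (0∸n≡0 i)) z≤n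
∸-suc-≤ (suc p) zero    = ≤-refl
∸-suc-≤ (suc p) (suc i) = ∸-suc-≤ p i

bound-sucRow : ∀ i j r p q → bound (suc i) j r p q ≤ bound i j r p q
bound-sucRow i j r p q = +-monoˡ-≤ (q ∸ j) (+-monoʳ-≤ r (∸-monoʳ-≤ p (n≤1+n i)))

bound-sucCol : ∀ i j r p q → bound i (suc j) r p q ≤ bound i j r p q
bound-sucCol i j r p q = +-monoʳ-≤ (r + (p ∸ i)) (∸-monoʳ-≤ q (n≤1+n j))

bound-sucRowRank : ∀ i j t p q → bound i j t p q ≤ bound (suc i) j (suc t) p q
bound-sucRowRank i j t p q = +-monoˡ-≤ (q ∸ j) (≤-trans (+-monoʳ-≤ t (∸-suc-≤ p i)) (≤-reflexive (+-suc t _)))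

bound-sucColRank : ∀ i j t p q → bound i j t p q ≤ bound i (suc j) (suc t) p q
bound-sucColRank i j t p q = ≤-trans (+-monoʳ-≤ (t + (p ∸ i)) (∸-suc-≤ q j)) (≤-reflexive (+-suc (t + (p ∸ i)) _))

r<bound-below : ∀ i j r → r < bound i j r (suc i) j
r<bound-below i j r = ≤-trans (≤-reflexive (trans (+-comm 1 r) (cong (λ v → r + v) (sym (m+n∸n≡m 1 i))))) (m≤m+n _ _)

r<bound-right : ∀ i j r → r < bound i j r i (suc j)
r<bound-right i j r = ≤-trans (≤-reflexive (+-comm 1 r)) (+-mono-≤ (m≤m+n r (i ∸ i)) (≤-reflexive (sym (m+n∸n≡m 1 j))))

rk-bmat : ∀ A i j {r} → rk A i j ≡ + r → ∀ p q → rk (bmat A i j) p q ≡ + bRank i j r p q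
rk-bmat A i j {r} rA≡r p q = trans (cong (λ z → rk (permMat (bperm i j ∣ z ∣)) p q) rA≡r) (rk-bperm i j r p q)

Above : ℕ → Matrix → ℕ → ℕ → Set
Above n A i j = Σ ℕ λ i' → Σ ℕ λ j' → InRange n i' × InRange n j' × (bmat A i j <[ n ] bmat A i' j')

above-by-bRank : ∀ {n} A i j i' j' {r r'} → rk A i j ≡ + r → rk A i' j' ≡ + r' → InRange n i' → InRange n j' →
  (∀ p q → bRank i' j' r' p q ≤ bRank i j r p q) → bRank i' j' r' i' j' < bRank i j r i' j' → Above n A i j
above-by-bRank {n} A i j i' j' {r} {r'} rA≡r rA'≡r' ri' rj' dominated strict =
  i' , j' , ri' , rj' , below , distinct
  where
  below : bmat A i j ≤[ n ] bmat A i' j'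
  below p q _ _ = subst₂ _≤ℤ_ (sym (rk-bmat A i' j' rA'≡r' p q)) (sym (rk-bmat A i j rA≡r p q)) (+≤+ (dominated p q))
  distinct : ¬ MatEq n (bmat A i j) (bmat A i' j')
  distinct same = <⇒≢ strict (sym (ℤP.+-injective (begin
    + bRank i j r i' j'        ≡⟨ sym (rk-bmat A i j rA≡r i' j') ⟩
    rk (bmat A i j) i' j'      ≡⟨ rk-cong same i' j' (proj₂ ri') (proj₂ rj') ⟩
    rk (bmat A i' j') i' j'    ≡⟨ rk-bmat A i' j' rA'≡r' i' j' ⟩
    + bRank i' j' r' i' j'     ∎)))
    where open ≡-Reasoning

above-by-bound : ∀ {n} A i j i' j' {r r'} → rk A i j ≡ + r → rk A i' j' ≡ + r' → InRange n i' → InRange n j' →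
  (∀ p q → bound i' j' r' p q ≤ bound i j r p q) → r' < i' → r' < j' → r' < bound i j r i' j' → Above n A i j
above-by-bound A i j i' j' {r} {r'} rA≡r rA'≡r' ri' rj' le r'<i' r'<j' r'<bound =
  above-by-bRank A i j i' j' rA≡r rA'≡r' ri' rj' (bRank-mono {i} {j} {r} {i'} {j'} {r'} le)
    (corner-strict {i} {j} {r} i' j' r' r'<i' r'<j' r'<bound)

inversionSum-factor : ∀ n (A : Matrix) i j →
  sumFromTo i n (λ k → sumFromTo j n (λ l → A i l *ℤ A k j)) ≡ sumFromTo j n (A i) *ℤ sumFromTo i n (λ k → A k j)
inversionSum-factor n A i j = begin
  sumTo (n ∸ i) (λ t → sumTo (n ∸ j) (λ l → A i (j + l) *ℤ A (i + t) j))
    ≡⟨ sumTo-cong (n ∸ i) (λ t _ _ → sumTo-*ʳ (n ∸ j) (λ l → A i (j + l)) (A (i + t) j)) ⟩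
  sumTo (n ∸ i) (λ t → sumFromTo j n (A i) *ℤ A (i + t) j)
    ≡⟨ sumTo-*ˡ (n ∸ i) (λ t → A (i + t) j) (sumFromTo j n (A i)) ⟩
  sumFromTo j n (A i) *ℤ sumFromTo i n (λ k → A k j) ∎
  where open ≡-Reasoning

Inv-dec : ∀ n A i j → Dec (Inv n A i j)
Inv-dec n A i j = ((1 ≤? i) ×-dec (i ≤? n)) ×-dec (((1 ≤? j) ×-dec (j ≤? n)) ×-dec
  (sumFromTo i n (λ k → sumFromTo j n (λ l → A i l *ℤ A k j)) ℤ.≟ + 1))

next-inversion : ∀ n A i j → Inv n A i j → ¬ Ess n A i j → Inv n A (suc i) j ⊎ Inv n A i (suc j)
next-inversion n A i j inv notEss with Inv-dec n A (suc i) j | Inv-dec n A i (suc j)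
... | yes below  | _         = inj₁ below
... | no _       | yes right = inj₂ right
... | no ¬below  | no ¬right = ⊥-elim (notEss (inv , ¬below , ¬right))

boundedSearch : ∀ m {Q E : ℕ → Set} → (∀ p → InRange m p → Q p ⊎ E p) →
  (∀ p → InRange m p → Q p) ⊎ Σ ℕ λ p → InRange m p × E p
boundedSearch zero    choice = inj₁ (λ p (p≥1 , p≤0) → ⊥-elim (<⇒≱ p≥1 p≤0))
boundedSearch (suc m) {Q} choice with boundedSearch m (λ p (p≥1 , p≤m) → choice p (p≥1 , ≤-trans p≤m (n≤1+n m)))
... | inj₂ (p , (p≥1 , p≤m) , e) = inj₂ (p , (p≥1 , ≤-trans p≤m (n≤1+n m)) , e)
... | inj₁ upToM with choice (suc m) (s≤s z≤n , ≤-refl)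
...   | inj₂ e    = inj₂ (suc m , (s≤s z≤n , ≤-refl) , e)
...   | inj₁ atSM = inj₁ everywhere
  where
  everywhere : ∀ p → InRange (suc m) p → Q p
  everywhere p (p≥1 , p≤sm) with m≤n⇒m<n∨m≡n p≤sm
  ... | inj₁ p<sm = upToM p (p≥1 , ≤-pred p<sm)
  ... | inj₂ refl = atSM

module ASM {n : ℕ} {A : Matrix} (asm : IsASM n A) where
  open IsASM asm

  rowPrefix01 : ∀ i j → InRange n i → j ≤ n → (sumTo j (A i) ≡ + 0) ⊎ (sumTo j (A i) ≡ + 1)
  rowPrefix01 i j ri = AlternatingSequence.prefixSum01 n (A i)
    (λ l l≥1 l≤n → entries i l ri (l≥1 , l≤n)) (rowSum i ri) (λ l l' → rowAlt i l l' ri) j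

  colPrefix01 : ∀ i j → InRange n j → i ≤ n → (sumTo i (λ k → A k j) ≡ + 0) ⊎ (sumTo i (λ k → A k j) ≡ + 1)
  colPrefix01 i j rj = AlternatingSequence.prefixSum01 n (λ k → A k j)
    (λ k k≥1 k≤n → entries k j (k≥1 , k≤n) rj) (colSum j rj) (λ k k' → colAlt j k k' rj) i

  -- r_A(p,q) is a natural number at most min(p,q): it sums p row prefixes and q column prefixes
  rk-value : ∀ p q → p ≤ n → q ≤ n → Σ ℕ λ x → (rk A p q ≡ + x) × (x ≤ p) × (x ≤ q)
  rk-value p q p≤n q≤n
    with sumTo-01 p (λ k → sumTo q (A k)) (λ k k≥1 k≤p → rowPrefix01 k q (k≥1 , ≤-trans k≤p p≤n) q≤n)
       | sumTo-01 q (λ l → sumTo p (λ k → A k l)) (λ l l≥1 l≤q → colPrefix01 p l (l≥1 , ≤-trans l≤q q≤n) p≤n)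
  ... | x , byRows , x≤p | y , byCols , y≤q =
    x , byRows , x≤p , subst (_≤ q) (ℤP.+-injective (trans (sym byCols) (trans (sym (sumTo-swap p q A)) byRows))) y≤q

  complement-of-0 : ∀ {a b : ℤ} → a +ℤ b ≡ + 1 → a ≡ + 0 → b ≡ + 1
  complement-of-0 {b = b} sum refl = trans (sym (ℤP.+-identityˡ b)) sum

  complement-of-1 : ∀ {a b : ℤ} → a +ℤ b ≡ + 1 → a ≡ + 1 → b ≡ + 0
  complement-of-1 {b = b} sum refl = +ℤ-cancelˡ (+ 1) b (+ 0) sum

  rowSplit : ∀ i j → InRange n i → j ≤ n → sumTo j (A i) +ℤ sumFromTo j n (A i) ≡ + 1
  rowSplit i j ri j≤n = trans (sym (sumTo-split (A i) j≤n)) (rowSum i ri)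

  colSplit : ∀ i j → InRange n j → i ≤ n → sumTo i (λ k → A k j) +ℤ sumFromTo i n (λ k → A k j) ≡ + 1
  colSplit i j rj i≤n = trans (sym (sumTo-split (λ k → A k j) i≤n)) (colSum j rj)

  inversion-prefixes : ∀ i j → Inv n A i j → (sumTo j (A i) ≡ + 0) × (sumTo i (λ k → A k j) ≡ + 0)
  inversion-prefixes i j (ri , rj , inv) = rowPart , colPart
    where
    product : sumFromTo j n (A i) *ℤ sumFromTo i n (λ k → A k j) ≡ + 1
    product = trans (sym (inversionSum-factor n A i j)) inv
    rowPart : sumTo j (A i) ≡ + 0
    rowPart with rowPrefix01 i j ri (proj₂ rj)
    ... | inj₁ row0 = row0
    ... | inj₂ row1 with trans (sym product) (cong (_*ℤ sumFromTo i n (λ k → A k j)) (complement-of-1 (rowSplit i j ri (proj₂ rj)) row1))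
    ...   | ()
    colPart : sumTo i (λ k → A k j) ≡ + 0
    colPart with colPrefix01 i j rj (proj₂ ri)
    ... | inj₁ col0 = col0
    ... | inj₂ col1 with trans (sym product)
                        (trans (cong (sumFromTo j n (A i) *ℤ_) (complement-of-1 (colSplit i j rj (proj₂ ri)) col1))
                               (ℤP.*-zeroʳ (sumFromTo j n (A i))))
    ...   | ()

  prefixes-inversion : ∀ i j → InRange n i → InRange n j →
    sumTo j (A i) ≡ + 0 → sumTo i (λ k → A k j) ≡ + 0 → Inv n A i j
  prefixes-inversion i j ri rj row0 col0 = ri , rj , trans (inversionSum-factor n A i j)
    (cong₂ _*ℤ_ (complement-of-0 (rowSplit i j ri (proj₂ rj)) row0) (complement-of-0 (colSplit i j rj (proj₂ ri)) col0))

  Deficient : ℕ → ℕ → Set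
  Deficient p q = Σ ℕ λ x → (rk A p q ≡ + x) × (x < p ⊓ q)

  full-or-deficient : ∀ p q → InRange n p → InRange n q → (rk A p q ≡ + (p ⊓ q)) ⊎ Deficient p q
  full-or-deficient p q rp rq with rk-value p q (proj₂ rp) (proj₂ rq)
  ... | x , rA≡x , x≤p , x≤q with x ≟ p ⊓ q
  ...   | yes refl = inj₁ rA≡x
  ...   | no x≢min = inj₂ (x , rA≡x , ≤∧≢⇒< (⊓-glb x≤p x≤q) x≢min)

  deficient-cell : ¬ MatEq n A Id → Σ ℕ λ p → Σ ℕ λ q → InRange n p × InRange n q × Deficient p q
  deficient-cell A≢I with boundedSearch n (λ p rp → boundedSearch n (λ q rq → full-or-deficient p q rp rq))
  ... | inj₂ (p , rp , q , rq , deficient) = p , q , rp , rq , deficient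
  ... | inj₁ full = ⊥-elim (A≢I (rk-determines sameRanks))
    where
    sameRanks : ∀ p q → p ≤ n → q ≤ n → rk A p q ≡ rk Id p q
    sameRanks zero    q       _   _   = refl
    sameRanks (suc p) zero    _   _   = trans (sumTo-zero (suc p)) (sym (sumTo-zero (suc p)))
    sameRanks (suc p) (suc q) p<n q<n =
      trans (full (suc p) (s≤s z≤n , p<n) (suc q) (s≤s z≤n , q<n)) (sym (rk-Id (suc p) (suc q)))

  above-trivial : ∀ i j {r} → ¬ MatEq n A Id → rk A i j ≡ + r → i ⊓ j ≤ r → Above n A i j
  above-trivial i j {r} A≢I rA≡r trivial with deficient-cell A≢I
  ... | p , q , rp , rq , x , rA≡x , x<min = above-by-bRank A i j p q rA≡r rA≡x rp rq dominated strict
    where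
    dominated : ∀ p' q' → bRank p q x p' q' ≤ bRank i j r p' q'
    dominated p' q' = subst (bRank p q x p' q' ≤_) (sym (bRank-trivial i j r p' q' trivial)) (bRank-≤-min p q x p' q')
    strict : bRank p q x p q < bRank i j r p q
    strict = subst (bRank p q x p q <_) (sym (bRank-trivial i j r p q trivial)) (≤-<-trans (bRank-corner p q x) x<min)

  above-rowPrefix1 : ∀ i j {r} → InRange n i → InRange n j → rk A i j ≡ + r → r < i ⊓ j →
    sumTo j (A i) ≡ + 1 → Above n A i j
  above-rowPrefix1 zero j (() , _)
  above-rowPrefix1 (suc i) j {r} (_ , i<n) rj rA≡r r<min row1 with rk-value i j (≤-trans (n≤1+n i) i<n) (proj₂ rj)
  ... | t , rA≡t , _ , _ = above-by-bound A (suc i) j i j rA≡st rA≡t (≤-trans (s≤s z≤n) t<i , ≤-trans (n≤1+n i) i<n) rj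
      (bound-sucRowRank i j t) t<i t<j (r≤bound (suc i) j (suc t) i j)
    where
    rA≡st : rk A (suc i) j ≡ + suc t
    rA≡st = trans (cong₂ _+ℤ_ rA≡t row1) (cong +_ (+-comm t 1))
    st<min : suc t < suc i ⊓ j
    st<min = subst (_< suc i ⊓ j) (ℤP.+-injective (trans (sym rA≡r) rA≡st)) r<min
    t<i : t < i
    t<i = ≤-pred (≤-trans st<min (m⊓n≤m (suc i) j))
    t<j : t < j
    t<j = ≤-trans (n≤1+n _) (≤-trans st<min (m⊓n≤n (suc i) j))

  above-colPrefix1 : ∀ i j {r} → InRange n i → InRange n j → rk A i j ≡ + r → r < i ⊓ j →
    sumTo i (λ k → A k j) ≡ + 1 → Above n A i j
  above-colPrefix1 i zero _ (() , _)
  above-colPrefix1 i (suc j) {r} ri (_ , j<n) rA≡r r<min col1 with rk-value i j (proj₂ ri) (≤-trans (n≤1+n j) j<n)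
  ... | t , rA≡t , _ , _ = above-by-bound A i (suc j) i j rA≡st rA≡t ri (≤-trans (s≤s z≤n) t<j , ≤-trans (n≤1+n j) j<n)
      (bound-sucColRank i j t) t<i t<j (r≤bound i (suc j) (suc t) i j)
    where
    rA≡st : rk A i (suc j) ≡ + suc t
    rA≡st = trans (rk-sucCol A i j) (trans (cong₂ _+ℤ_ rA≡t col1) (cong +_ (+-comm t 1)))
    st<min : suc t < i ⊓ suc j
    st<min = subst (_< i ⊓ suc j) (ℤP.+-injective (trans (sym rA≡r) rA≡st)) r<min
    t<i : t < i
    t<i = ≤-trans (n≤1+n _) (≤-trans st<min (m⊓n≤m i (suc j)))
    t<j : t < j
    t<j = ≤-pred (≤-trans st<min (m⊓n≤n i (suc j)))

  above-inversionBelow : ∀ i j {r} → rk A i j ≡ + r → r < i ⊓ j → Inv n A (suc i) j → Above n A i j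
  above-inversionBelow i j {r} rA≡r r<min inv@(rsi , rj , _) =
    above-by-bound A i j (suc i) j rA≡r rA'≡r rsi rj (bound-sucRow i j r)
      (≤-trans r<min (≤-trans (m⊓n≤m i j) (n≤1+n i))) (≤-trans r<min (m⊓n≤n i j)) (r<bound-below i j r)
    where
    rA'≡r : rk A (suc i) j ≡ + r
    rA'≡r = trans (cong (rk A i j +ℤ_) (proj₁ (inversion-prefixes (suc i) j inv))) (trans (ℤP.+-identityʳ _) rA≡r)

  above-inversionRight : ∀ i j {r} → rk A i j ≡ + r → r < i ⊓ j → Inv n A i (suc j) → Above n A i j
  above-inversionRight i j {r} rA≡r r<min inv@(ri , rsj , _) =
    above-by-bound A i j i (suc j) rA≡r rA'≡r ri rsj (bound-sucCol i j r)
      (≤-trans r<min (m⊓n≤m i j)) (≤-trans r<min (≤-trans (m⊓n≤n i j) (n≤1+n j))) (r<bound-right i j r)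
    where
    rA'≡r : rk A i (suc j) ≡ + r
    rA'≡r = trans (rk-sucCol A i j)
      (trans (cong (rk A i j +ℤ_) (proj₂ (inversion-prefixes i (suc j) inv))) (trans (ℤP.+-identityʳ _) rA≡r))

lemma3p10 : (n : ℕ) (A : Matrix) → IsASM n A → ¬ MatEq n A Id →
    (i j : ℕ) → InRange n i → InRange n j → ¬ Ess n A i j →
    Σ ℕ (λ i' → Σ ℕ (λ j' → InRange n i' × InRange n j' ×
      (bmat A i j <[ n ] bmat A i' j')))
lemma3p10 n A asm A≢I i j ri rj notEss = withRank (rk-value i j (proj₂ ri) (proj₂ rj))
  where
  open ASM asm
  withRank : (Σ ℕ λ r → (rk A i j ≡ + r) × (r ≤ i) × (r ≤ j)) → Above n A i j
  withRank (r , rA≡r , _) with i ⊓ j ≤? r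
  ... | yes trivial = above-trivial i j A≢I rA≡r trivial
  ... | no ¬trivial with rowPrefix01 i j ri (proj₂ rj) | colPrefix01 i j rj (proj₂ ri)
  ...   | inj₂ row1 | _         = above-rowPrefix1 i j ri rj rA≡r (≰⇒> ¬trivial) row1
  ...   | inj₁ _    | inj₂ col1 = above-colPrefix1 i j ri rj rA≡r (≰⇒> ¬trivial) col1
  ...   | inj₁ row0 | inj₁ col0 with next-inversion n A i j (prefixes-inversion i j ri rj row0 col0) notEss
  ...     | inj₁ below = above-inversionBelow i j rA≡r (≰⇒> ¬trivial) below
  ...     | inj₂ right = above-inversionRight i j rA≡r (≰⇒> ¬trivial) right
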